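{- Let $\Lambda=(\mathcal{L},\mathfrak{M},\models)$ be a satisfaction system and $\oplus:\mathcal{P}_{\mathrm{fin}}(\mathcal{L})\times\mathcal{P}(\mathfrak{M})\to\mathcal{P}_{\mathrm{fin}}(\mathcal{L})$ a model change operation satisfying (persistence) $\mathrm{Mod}(B)\subseteq\mathrm{Mod}(\oplus(B,\mathbb{M}))$ for all $B,\mathbb{M}$, and (finite temperance) for all $B,\mathbb{M}$ and $\mathbb{M}''$: if $\mathrm{Mod}(B)\cup\mathbb{M}\subseteq\mathbb{M}''\subsetneq\mathrm{Mod}(\oplus(B,\mathbb{M}))$ then $\mathbb{M}''\notin\mathrm{FR}(\Lambda)$. Then $\oplus$ satisfies (vacuity): for all $B\in\mathcal{P}_{\mathrm{fin}}(\mathcal{L})$ and $\mathbb{M}\subseteq\mathfrak{M}$, if $\mathbb{M}\subseteq\mathrm{Mod}(B)$ then $\mathrm{Mod}(\oplus(B,\mathbb{M}))=\mathrm{Mod}(B)$.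
   Context: A satisfaction system is a triple $\Lambda=(\mathcal{L},\mathfrak{M},\models)$ where $\mathcal{L}$ is a set of formulae, $\mathfrak{M}$ a set of models, and $\models$ a relation between models and sets of formulae $B\subseteq\mathcal{L}$. $\mathrm{Mod}(B)=\{m\in\mathfrak{M}\mid m\models B\}$. $\mathcal{P}(A)$ is the power set of $A$, $\mathcal{P}_{\mathrm{fin}}(A)$ the set of finite subsets of $A$. $\mathrm{FR}(\Lambda)=\{X\subseteq\mathfrak{M}\mid X=\mathrm{Mod}(B)$ for some $B\in\mathcal{P}_{\mathrm{fin}}(\mathcal{L})\}$. Quantifiers over $B$ range over $\mathcal{P}_{\mathrm{fin}}(\mathcal{L})$, over $\mathbb{M},\mathbb{M}''$ over subsets of $\mathfrak{M}$. -}

module Defs where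

open import Level using (Level; _⊔_; suc)
open import Data.List using (List)
open import Data.List.Membership.Propositional using (_∈_)
open import Data.Product using (Σ; _×_)
open import Relation.Nullary using (¬_)
open import Relation.Unary using (Pred; _⊆_; _∪_)

record SatisfactionSystem (a b ℓ : Level) : Set (suc (a ⊔ b ⊔ ℓ)) where
  field
    Formula : Set a
    Model   : Set b
    _⊨_     : Model → Pred Formula a → Set ℓ

module _ {a b ℓ} (Λ : SatisfactionSystem a b ℓ) where
  open SatisfactionSystem Λ

  -- Finite subsets of the formulae, represented by (finite) lists.
  FinFormulae : Set a
  FinFormulae = List Formula

  ⟦_⟧ : FinFormulae → Pred Formula a
  ⟦ B ⟧ φ = φ ∈ B

  Mod : FinFormulae → Pred Model ℓ
  Mod B m = m ⊨ ⟦ B ⟧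

  _≐_ : ∀ {p q} → Pred Model p → Pred Model q → Set (b ⊔ p ⊔ q)
  X ≐ Y = (X ⊆ Y) × (Y ⊆ X)

  _⊊_ : ∀ {p q} → Pred Model p → Pred Model q → Set (b ⊔ p ⊔ q)
  X ⊊ Y = (X ⊆ Y) × ¬ (Y ⊆ X)

  InFR : ∀ {p} → Pred Model p → Set (a ⊔ b ⊔ ℓ ⊔ p)
  InFR X = Σ FinFormulae (λ B → X ≐ Mod B)

  ModelChange : (ℓ' : Level) → Set (a ⊔ b ⊔ suc ℓ')
  ModelChange ℓ' = FinFormulae → Pred Model ℓ' → FinFormulae

  Persistence : ∀ {ℓ'} → ModelChange ℓ' → Set (a ⊔ b ⊔ ℓ ⊔ suc ℓ')
  Persistence ⊕ = ∀ B 𝕄 → Mod B ⊆ Mod (⊕ B 𝕄)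

  FiniteTemperance : ∀ {ℓ'} → ModelChange ℓ' → Set (a ⊔ b ⊔ suc ℓ ⊔ suc ℓ')
  FiniteTemperance {ℓ'} ⊕ = ∀ B (𝕄 : Pred Model ℓ') (𝕄'' : Pred Model (ℓ ⊔ ℓ')) →
    (Mod B ∪ 𝕄) ⊆ 𝕄'' → 𝕄'' ⊊ Mod (⊕ B 𝕄) → ¬ InFR 𝕄''

  Vacuity : ∀ {ℓ'} → ModelChange ℓ' → Set (a ⊔ b ⊔ ℓ ⊔ suc ℓ')
  Vacuity ⊕ = ∀ B 𝕄 → 𝕄 ⊆ Mod B → Mod (⊕ B 𝕄) ≐ Mod B

{-# OPTIONS --safe #-}
module Submission where

-- Mod B itself lies in FR(Λ) and sits between Mod B ∪ 𝕄 and Mod (⊕ B 𝕄), so finite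
-- temperance forbids the inclusion Mod B ⊆ Mod (⊕ B 𝕄) given by persistence from being
-- strict. Refuting strictness yields the reverse inclusion only classically, one model at a time.

open import Level using (_⊔_; Lift; lift; lower)
open import Axiom.ExcludedMiddle using (ExcludedMiddle)
open import Relation.Nullary using (¬_; yes; no)
open import Relation.Unary using (Pred; _⊆_; _∪_)
open import Data.Product using (_,_)
open import Data.Sum using (inj₁; inj₂)
open import Data.Empty using (⊥-elim)
open import Defs

module _ {a b ℓ ℓ'} (Λ : SatisfactionSystem a b ℓ) (⊕ : ModelChange Λ ℓ') where
  open SatisfactionSystem Λ using (Model)

  -- Finite temperance quantifies over sets of models at level ℓ ⊔ ℓ'.
  LiftedMod : FinFormulae Λ → Pred Model (ℓ ⊔ ℓ')
  LiftedMod B m = Lift ℓ' (Mod Λ B m)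

  LiftedMod-∈FR : ∀ B → InFR Λ (LiftedMod B)
  LiftedMod-∈FR B = B , lower , lift

  Mod∪⊆LiftedMod : ∀ B (𝕄 : Pred Model ℓ') → 𝕄 ⊆ Mod Λ B → (Mod Λ B ∪ 𝕄) ⊆ LiftedMod B
  Mod∪⊆LiftedMod B 𝕄 𝕄⊆ModB (inj₁ m⊨B) = lift m⊨B
  Mod∪⊆LiftedMod B 𝕄 𝕄⊆ModB (inj₂ m∈𝕄) = lift (𝕄⊆ModB m∈𝕄)

  LiftedMod-⊊-Mod⊕ : Persistence Λ ⊕ → ∀ B 𝕄 {m} → Mod Λ (⊕ B 𝕄) m → ¬ Mod Λ B m →
                     _⊊_ Λ (LiftedMod B) (Mod Λ (⊕ B 𝕄))
  LiftedMod-⊊-Mod⊕ pers B 𝕄 m⊨⊕B m⊭B =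
    (λ m⊨B → pers B 𝕄 (lower m⊨B)) , λ ⊆ModB → m⊭B (lower (⊆ModB m⊨⊕B))

  Mod⊕-⊆-Mod : ExcludedMiddle ℓ → Persistence Λ ⊕ → FiniteTemperance Λ ⊕ →
               ∀ B 𝕄 → 𝕄 ⊆ Mod Λ B → Mod Λ (⊕ B 𝕄) ⊆ Mod Λ B
  Mod⊕-⊆-Mod em pers temp B 𝕄 𝕄⊆ModB {m} m⊨⊕B with em {Mod Λ B m}
  ... | yes m⊨B = m⊨B
  ... | no m⊭B  = ⊥-elim (temp B 𝕄 (LiftedMod B) (Mod∪⊆LiftedMod B 𝕄 𝕄⊆ModB)
                            (LiftedMod-⊊-Mod⊕ pers B 𝕄 m⊨⊕B m⊭B) (LiftedMod-∈FR B))

proposition4 : ∀ {a b ℓ ℓ'} → ExcludedMiddle ℓ →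
    (Λ : SatisfactionSystem a b ℓ) (⊕ : ModelChange Λ ℓ') →
    Persistence Λ ⊕ → FiniteTemperance Λ ⊕ → Vacuity Λ ⊕
proposition4 em Λ ⊕ pers temp B 𝕄 𝕄⊆ModB =
  Mod⊕-⊆-Mod Λ ⊕ em pers temp B 𝕄 𝕄⊆ModB , pers B 𝕄
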